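{- For every (finite, simple, connected) graph $G$ and every integer $n\geq 2\beta(G)+1$, we have $\beta(K_n\,\square\,G)=n-1$.
   Context: $K_n$ is the complete graph on $n$ vertices. $d(v,w)$ denotes shortest-path distance. A vertex $x$ resolves $v,w$ if $d(v,x)\neq d(w,x)$; a set resolves a graph if every pair of distinct vertices is resolved by some vertex of the set; $\beta(G)$ is the minimum size of a resolving set. The cartesian product $G\,\square\,H$ has vertex set $V(G)\times V(H)$, with $(a,v)\sim(b,w)$ iff ($a=b$ and $vw\in E(H)$) or ($v=w$ and $ab\in E(G)$). -}

module Defs where

open import Data.Nat using (ℕ; zero; suc; _*_; _<_)
open import Data.Bool using (Bool; true; false; _∧_; _∨_; not)
open import Data.Fin using (Fin; remQuot; _≟_)
open import Data.Fin.Subset using (Subset; _∈_; ∣_∣)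
open import Data.Product using (Σ; ∃; _×_; _,_; proj₁; proj₂)
open import Relation.Nullary using (¬_)
open import Relation.Nullary.Decidable using (⌊_⌋)
open import Relation.Binary.PropositionalEquality using (_≡_; _≢_)

record RawGraph : Set where
  field
    order : ℕ
    adj   : Fin order → Fin order → Bool
open RawGraph public

record Graph : Set where
  field
    raw    : RawGraph
    sym    : ∀ u v → adj raw u v ≡ adj raw v u
    irrefl : ∀ u → adj raw u u ≡ false
open Graph public

module _ (G : RawGraph) where
  V : Set
  V = Fin (order G)

  data Walk : V → V → ℕ → Set where
    here : ∀ {u} → Walk u u zero
    step : ∀ {u w v k} → adj G u w ≡ true → Walk w v k → Walk u v (suc k)

  Dist : V → V → ℕ → Set
  Dist u v k = Walk u v k × (∀ j → j < k → ¬ Walk u v j)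

  Connected : Set
  Connected = ∀ u v → ∃ λ k → Walk u v k

  ResolvesPair : V → V → V → Set
  ResolvesPair x v w = ∀ a b → Dist v x a → Dist w x b → a ≢ b

  Resolving : Subset (order G) → Set
  Resolving S = ∀ v w → v ≢ w → Σ V λ x → x ∈ S × ResolvesPair x v w

  IsMetricDim : ℕ → Set
  IsMetricDim k = (Σ (Subset (order G)) λ S → Resolving S × ∣ S ∣ ≡ k)
                × (∀ S → Resolving S → k Data.Nat.≤ ∣ S ∣)

K : ℕ → RawGraph
K n = record { order = n ; adj = λ i j → not ⌊ i ≟ j ⌋ }

-- cartesian product; vertex p of Fin (order G * order H) is the pair remQuot p
_□_ : RawGraph → RawGraph → RawGraph
G □ H = record { order = order G * order H ; adj = A }
  where
  A : Fin (order G * order H) → Fin (order G * order H) → Bool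
  A p q with remQuot (order H) p | remQuot (order H) q
  ... | (a , v) | (b , w) = (⌊ a ≟ b ⌋ ∧ adj H v w) ∨ (⌊ v ≟ w ⌋ ∧ adj G a b)

{-# OPTIONS --safe #-}
module Submission where

-- In K n □ H the distance from (a, v) to (l, x) is [a ≠ l] + d_H(v, x); call {a} × V(H) a layer.
--
-- Lower bound: if a resolving set S missed two layers a₀ ≠ a₁, then (a₀, v) and (a₁, v) would
-- both be at distance 1 + d_H(v, x) from every landmark (c, x) of S; so S meets at least n − 1
-- layers.
--
-- Upper bound: let W resolve H with 2|W| ≤ n − 1.  Put one landmark in each layer 1, …, n − 1,
-- using every vertex of W in two different layers.  Vertices (a, v), (c, v) of the same column
-- are separated by the landmark in the layer of one of them, as only layer 0 is empty.  Vertices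
-- (a, v), (c, w) with v ≠ w are separated in H by some x ∈ W, say d_H(v, x) < d_H(w, x).  A
-- landmark (l, x) fails only if [a ≠ l] + d_H(v, x) = [c ≠ l] + d_H(w, x), which forces l = c;
-- so at most one of the two copies of x fails.

open import Defs hiding (sym)
open import Data.Nat using (ℕ; _*_; _+_; _∸_; _≤_; suc; zero; _<_; z≤n; s≤s)
open import Data.Nat.Induction using (<-wellFounded)
open import Data.Nat.Properties
  using (≤-antisym; ≮⇒≥; <⇒≱; <-cmp; ≤-pred; n≤0⇒n≡0; m≤n⇒m≤1+n; m+n≤o⇒n≤o; m≤n⇒∃[o]m+o≡n;
         +-comm; +-suc; +-identityʳ; +-mono-≤; +-monoˡ-≤; +-cancelʳ-≤; +-cancelʳ-≡; anyUpTo?;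
         module ≤-Reasoning)
  renaming (_≟_ to _≟ℕ_)
open import Data.Bool using (Bool; true; false; _∧_; _∨_)
import Data.Bool.Properties as Bool
open import Data.Fin
  using (Fin; zero; suc; _≟_; fromℕ<; remQuot; combine; _↑ˡ_; _↑ʳ_; splitAt; punchIn)
open import Data.Fin.Properties
  using (any?; remQuot-combine; combine-surjective; combine-injective; injective⇒≤; suc-injective;
         punchIn-injective; punchInᵢ≢i; splitAt-↑ˡ; splitAt-↑ʳ; ↑ˡ-injective)
open import Data.Fin.Subset using (Subset; _∈_; ∣_∣; inside; outside; ⁅_⁆; ⊥)
open import Data.Fin.Subset.Properties using (_∈?_; x∈⁅x⁆; ∣⁅x⁆∣≡1; ∣⊥∣≡0)
open import Data.Vec using ([]; _∷_; _++_; concat; tabulate; lookup; here; there)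
open import Data.Vec.Properties using (lookup-concat; lookup∘tabulate; lookup⇒[]=; []=⇒lookup)
open import Data.Product as Product using (Σ; ∃; ∃₂; _×_; _,_; proj₁; proj₂)
open import Data.Sum using (_⊎_; inj₁; inj₂; [_,_]′)
open import Function using (_∘_; id; const)
open import Function.Definitions using (Injective)
open import Induction.WellFounded using (Acc; acc)
open import Relation.Nullary using (¬_; Dec; yes; no; contradiction)
open import Relation.Nullary.Decidable using (_×-dec_; ¬?; isYes; decidable-stable)
open import Relation.Binary.PropositionalEquality
open import Relation.Binary.Definitions using (tri<; tri≈; tri>)

enumerate : ∀ {m} (p : Subset m) → Σ (Fin ∣ p ∣ → Fin m) λ e → ∀ {x} → x ∈ p → ∃ λ i → e i ≡ x
enumerate [] = (λ ()) , λ ()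
enumerate (inside ∷ p) with enumerate p
... | e , onto = (λ { zero → zero ; (suc i) → suc (e i) })
               , λ { here → zero , refl ; (there x∈p) → Product.map suc (cong suc) (onto x∈p) }
enumerate (outside ∷ p) with enumerate p
... | e , onto = suc ∘ e , λ { (there x∈p) → Product.map id (cong suc) (onto x∈p) }

injective⇒≤∣p∣ : ∀ {k m} {p : Subset m} (f : Fin k → Fin m) → Injective _≡_ _≡_ f
               → (∀ i → f i ∈ p) → k ≤ ∣ p ∣
injective⇒≤∣p∣ {k} {m} {p} f f-injective f∈p = injective⇒≤ {f = index} index-injective
  where
  e : Fin ∣ p ∣ → Fin m
  e = proj₁ (enumerate p)
  index : Fin k → Fin ∣ p ∣
  index i = proj₁ (proj₂ (enumerate p) (f∈p i))
  e∘index : ∀ i → e (index i) ≡ f i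
  e∘index i = proj₂ (proj₂ (enumerate p) (f∈p i))
  index-injective : Injective _≡_ _≡_ index
  index-injective {i} {j} eq = f-injective (trans (sym (e∘index i)) (trans (cong e eq) (e∘index j)))

∣p++q∣≡∣p∣+∣q∣ : ∀ {m k} (p : Subset m) (q : Subset k) → ∣ p ++ q ∣ ≡ ∣ p ∣ + ∣ q ∣
∣p++q∣≡∣p∣+∣q∣ [] q = refl
∣p++q∣≡∣p∣+∣q∣ (inside ∷ p) q = cong suc (∣p++q∣≡∣p∣+∣q∣ p q)
∣p++q∣≡∣p∣+∣q∣ (outside ∷ p) q = ∣p++q∣≡∣p∣+∣q∣ p q

layered : ∀ {k m} → (Fin k → Subset m) → Subset (k * m)
layered rows = concat (tabulate rows)

∈-layered : ∀ {k m} (rows : Fin k → Subset m) {l x} → x ∈ rows l → combine l x ∈ layered rows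
∈-layered rows {l} {x} x∈row = lookup⇒[]= (combine l x) (layered rows) (begin
  lookup (concat (tabulate rows)) (combine l x)  ≡⟨ lookup-concat (tabulate rows) l x ⟩
  lookup (lookup (tabulate rows) l) x  ≡⟨ cong (λ r → lookup r x) (lookup∘tabulate rows l) ⟩
  lookup (rows l) x                    ≡⟨ []=⇒lookup x∈row ⟩
  inside                               ∎)
  where open ≡-Reasoning

∣layered⁅⁆∣ : ∀ {k m} (f : Fin k → Fin m) → ∣ layered (⁅_⁆ ∘ f) ∣ ≡ k
∣layered⁅⁆∣ {zero} f = refl
∣layered⁅⁆∣ {suc k} f =
  trans (∣p++q∣≡∣p∣+∣q∣ ⁅ f zero ⁆ _) (cong₂ _+_ (∣⁅x⁆∣≡1 (f zero)) (∣layered⁅⁆∣ (f ∘ suc)))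

duplicate : ∀ {A : Set} {b k} → A → (e : Fin b → A) → b + b ≤ k
          → Σ (Fin k → A) λ f → ∀ j → ∃₂ λ i i′ → i ≢ i′ × f i ≡ e j × f i′ ≡ e j
duplicate {A} {b} a e b+b≤k with m≤n⇒∃[o]m+o≡n b+b≤k
... | o , refl = f , λ j → (j ↑ˡ b) ↑ˡ o , (b ↑ʳ j) ↑ˡ o , first≢second j , first j , second j
  where
  f : Fin (b + b + o) → A
  f i = [ [ e , e ]′ ∘ splitAt b , const a ]′ (splitAt (b + b) i)
  first : ∀ j → f ((j ↑ˡ b) ↑ˡ o) ≡ e j
  first j rewrite splitAt-↑ˡ (b + b) (j ↑ˡ b) o | splitAt-↑ˡ b j b = refl
  second : ∀ j → f ((b ↑ʳ j) ↑ˡ o) ≡ e j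
  second j rewrite splitAt-↑ˡ (b + b) (b ↑ʳ j) o | splitAt-↑ʳ b b j = refl
  first≢second : ∀ j → (j ↑ˡ b) ↑ˡ o ≢ (b ↑ʳ j) ↑ˡ o
  first≢second j eq with () ← trans (sym (splitAt-↑ˡ b j b))
    (trans (cong (splitAt b) (↑ˡ-injective o _ _ eq)) (splitAt-↑ʳ b b j))

module _ {R : RawGraph} where

  _++ʷ_ : ∀ {u v w i j} → Walk R u v i → Walk R v w j → Walk R u w (i + j)
  here ++ʷ q = q
  step e p ++ʷ q = step e (p ++ʷ q)

  walk? : ∀ u v k → Dec (Walk R u v k)
  walk? u v zero with u ≟ v
  ... | yes refl = yes here
  ... | no u≢v = no λ { here → u≢v refl }
  walk? u v (suc k) with any? (λ w → (adj R u w Bool.≟ true) ×-dec walk? w v k)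
  ... | yes (w , e , p) = yes (step e p)
  ... | no ∄ = no λ { (step e p) → ∄ (_ , e , p) }

  dist-minimal : ∀ {u v d k} → Dist R u v d → Walk R u v k → d ≤ k
  dist-minimal (_ , minimal) p = ≮⇒≥ λ k<d → minimal _ k<d p

  dist-unique : ∀ {u v i j} → Dist R u v i → Dist R u v j → i ≡ j
  dist-unique D D′ = ≤-antisym (dist-minimal D (proj₁ D′)) (dist-minimal D′ (proj₁ D))

  dist≡0⇒≡ : ∀ {u v} → Dist R u v 0 → u ≡ v
  dist≡0⇒≡ (here , _) = refl

  dist-self≡0 : ∀ {u d} → Dist R u u d → d ≡ 0
  dist-self≡0 D = n≤0⇒n≡0 (dist-minimal D here)

  walk⇒dist : ∀ {u v k} → Walk R u v k → ∃ (Dist R u v)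
  walk⇒dist = shorten (<-wellFounded _)
    where
    shorten : ∀ {u v k} → Acc _<_ k → Walk R u v k → ∃ (Dist R u v)
    shorten {u} {v} {k} (acc shorter) p with anyUpTo? (walk? u v) k
    ... | yes (j , j<k , q) = shorten (shorter j<k) q
    ... | no ∄ = k , p , λ j j<k q → ∄ (j , j<k , q)

  connected⇒dist : Connected R → ∀ u v → ∃ (Dist R u v)
  connected⇒dist connected u v = walk⇒dist (proj₂ (connected u v))

  resolves-sym : ∀ {x v w} → ResolvesPair R x v w → ResolvesPair R x w v
  resolves-sym resolves α β wα vβ α≡β = resolves β α vβ wα (sym α≡β)

  resolves-or-equidistant : Connected R → ∀ x v w
                          → ResolvesPair R x v w ⊎ ∃ λ d → Dist R v x d × Dist R w x d
  resolves-or-equidistant connected x v w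
    with connected⇒dist connected v x | connected⇒dist connected w x
  ... | i , vx | j , wx with i ≟ℕ j
  ... | yes refl = inj₂ (i , vx , wx)
  ... | no i≢j = inj₁ λ α β vα wβ α≡β →
    i≢j (trans (dist-unique vx vα) (trans α≡β (dist-unique wβ wx)))

module _ (G H : RawGraph) where

  data □-Edge : V G × V H → V G × V H → Set where
    moveˡ : ∀ {a b v} → adj G a b ≡ true → □-Edge (a , v) (b , v)
    moveʳ : ∀ {a v w} → adj H v w ≡ true → □-Edge (a , v) (a , w)

  □-adj : V G × V H → V G × V H → Bool
  □-adj (a , v) (b , w) = (isYes (a ≟ b) ∧ adj H v w) ∨ (isYes (v ≟ w) ∧ adj G a b)

  adj-combine : ∀ a v b w → adj (G □ H) (combine a v) (combine b w) ≡ □-adj (a , v) (b , w)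
  adj-combine a v b w = cong₂ □-adj (remQuot-combine a v) (remQuot-combine b w)

  □-adj⇒□-Edge : ∀ {x y} → □-adj x y ≡ true → □-Edge x y
  □-adj⇒□-Edge {a , v} {b , w} e with a ≟ b | v ≟ w | adj H v w in eH | adj G a b in eG | e
  ... | yes refl | _        | true  | _     | _  = moveʳ eH
  ... | _        | yes refl | _     | true  | _  = moveˡ eG
  ... | yes refl | yes refl | false | false | ()
  ... | yes refl | no _     | false | _     | ()
  ... | no _     | yes refl | _     | false | ()
  ... | no _     | no _     | _     | _     | ()

  □-Edge⇒□-adj : ∀ {x y} → □-Edge x y → □-adj x y ≡ true
  □-Edge⇒□-adj (moveˡ {v = v} e) with v ≟ v
  ... | yes _ rewrite e = Bool.∨-zeroʳ _
  ... | no v≢v = contradiction refl v≢v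
  □-Edge⇒□-adj (moveʳ {a = a} e) with a ≟ a
  ... | yes _ rewrite e = refl
  ... | no a≢a = contradiction refl a≢a

  walkˡ : ∀ {a b i} (v : V H) → Walk G a b i → Walk (G □ H) (combine a v) (combine b v) i
  walkˡ v here = here
  walkˡ v (step e p) = step (trans (adj-combine _ v _ v) (□-Edge⇒□-adj (moveˡ e))) (walkˡ v p)

  walkʳ : ∀ {v w j} (a : V G) → Walk H v w j → Walk (G □ H) (combine a v) (combine a w) j
  walkʳ a here = here
  walkʳ a (step e q) = step (trans (adj-combine a _ a _) (□-Edge⇒□-adj (moveʳ e))) (walkʳ a q)

  walk-□ : ∀ {a b v w i j} → Walk G a b i → Walk H v w j
         → Walk (G □ H) (combine a v) (combine b w) (i + j)
  walk-□ {b = b} {v} p q = walkˡ v p ++ʷ walkʳ b q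

  WalkPair : V G × V H → V G × V H → ℕ → Set
  WalkPair (a , v) (b , w) k = ∃₂ λ i j → Walk G a b i × Walk H v w j × i + j ≡ k

  unzip-walk : ∀ {p q k} → Walk (G □ H) p q k
             → WalkPair (remQuot (order H) p) (remQuot (order H) q) k
  unzip-walk here = 0 , 0 , here , here , refl
  unzip-walk (step e r) = cons (□-adj⇒□-Edge e) (unzip-walk r)
    where
    cons : ∀ {x y z k} → □-Edge x y → WalkPair y z k → WalkPair x z (suc k)
    cons (moveˡ e) (i , j , p , q , refl) = suc i , j , step e p , q , refl
    cons (moveʳ e) (i , j , p , q , refl) = i , suc j , p , step e q , +-suc i j

  unzip-walk-combine : ∀ {a v b w k} → Walk (G □ H) (combine a v) (combine b w) k
                     → WalkPair (a , v) (b , w) k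
  unzip-walk-combine {a} {v} {b} {w} {k} r =
    subst₂ (λ x y → WalkPair x y k) (remQuot-combine a v) (remQuot-combine b w) (unzip-walk r)

  dist-□ : ∀ {a b v w i j} → Dist G a b i → Dist H v w j
         → Dist (G □ H) (combine a v) (combine b w) (i + j)
  dist-□ {i = i} {j} Dᵢ Dⱼ = walk-□ (proj₁ Dᵢ) (proj₁ Dⱼ) , shorter-impossible
    where
    shorter-impossible : ∀ k → k < i + j → ¬ Walk (G □ H) _ _ k
    shorter-impossible k k<i+j r with unzip-walk-combine r
    ... | _ , _ , p , q , refl = <⇒≱ k<i+j (+-mono-≤ (dist-minimal Dᵢ p) (dist-minimal Dⱼ q))

  dist-□⁻ : ∀ {a b v w d j} → Dist (G □ H) (combine a v) (combine b w) d → Dist H v w j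
          → ∃ λ i → Dist G a b i × d ≡ i + j
  dist-□⁻ D Dⱼ with unzip-walk-combine (proj₁ D)
  ... | _ , _ , p , _ with walk⇒dist p
  ... | i , Dᵢ = i , Dᵢ , dist-unique D (dist-□ Dᵢ Dⱼ)

  □-connected : Connected G → Connected H → Connected (G □ H)
  □-connected G-connected H-connected p q
    with combine-surjective {order G} p | combine-surjective {order G} q
  ... | a , v , refl | b , w , refl =
    _ , walk-□ (proj₂ (G-connected a b)) (proj₂ (H-connected v w))

  resolving-□ : ∀ {S} → (∀ a v b w → (a , v) ≢ (b , w) → Σ (V (G □ H)) λ x
                                    → x ∈ S × ResolvesPair (G □ H) x (combine a v) (combine b w))
              → Resolving (G □ H) S
  resolving-□ resolve p q p≢q
    with combine-surjective {order G} p | combine-surjective {order G} q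
  ... | a , v , refl | b , w , refl = resolve a v b w λ { refl → p≢q refl }

module _ {n : ℕ} where

  K-adj : ∀ {a b : Fin n} → a ≢ b → adj (K n) a b ≡ true
  K-adj {a} {b} a≢b with a ≟ b
  ... | yes a≡b = contradiction a≡b a≢b
  ... | no _ = refl

  K-dist : ∀ {a b : Fin n} → a ≢ b → Dist (K n) a b 1
  K-dist a≢b = step (K-adj a≢b) here , λ { 0 _ here → a≢b refl ; (suc _) (s≤s ()) _ }

  K-connected : Connected (K n)
  K-connected a b with a ≟ b
  ... | yes refl = 0 , here
  ... | no a≢b = 1 , step (K-adj a≢b) here

  K-dist≤1 : ∀ {a b : Fin n} {d} → Dist (K n) a b d → d ≤ 1
  K-dist≤1 {a} {b} D with a ≟ b
  ... | yes refl = m≤n⇒m≤1+n (dist-minimal D here)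
  ... | no a≢b = dist-minimal D (step (K-adj a≢b) here)

  K-compensates⇒≡ : ∀ {a c l : Fin n} {α γ p q} → Dist (K n) a l α → Dist (K n) c l γ
                  → α + p ≡ γ + q → p < q → c ≡ l
  K-compensates⇒≡ {c = c} {l} {α} {γ} {p} {q} Dα Dγ α+p≡γ+q p<q =
    dist≡0⇒≡ (subst (Dist (K n) c l) γ≡0 Dγ)
    where
    γ+q≤0+q : γ + q ≤ 0 + q
    γ+q≤0+q = begin
      γ + q  ≡⟨ sym α+p≡γ+q ⟩
      α + p  ≤⟨ +-monoˡ-≤ p (K-dist≤1 Dα) ⟩
      1 + p  ≤⟨ p<q ⟩
      q      ∎
      where open ≤-Reasoning
    γ≡0 : γ ≡ 0
    γ≡0 = n≤0⇒n≡0 (+-cancelʳ-≤ q γ 0 γ+q≤0+q)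

module _ (H : RawGraph) (H-connected : Connected H) where

  same-column-resolved : ∀ {n} {a c : Fin n} → a ≢ c
                       → ∀ v y → ResolvesPair (K n □ H) (combine a y) (combine a v) (combine c v)
  same-column-resolved {n} {a} {c} a≢c v y α β Dα Dβ α≡β with connected⇒dist H-connected v y
  ... | g , Dg with dist-□⁻ (K n) H Dα Dg | dist-□⁻ (K n) H Dβ Dg
  ... | α₀ , Dα₀ , α≡α₀+g | γ , Dγ , β≡γ+g = a≢c (sym (dist≡0⇒≡ (subst (Dist (K n) c a) γ≡0 Dγ)))
    where
    γ≡0 : γ ≡ 0
    γ≡0 = +-cancelʳ-≡ g γ 0 (begin
      γ + g   ≡⟨ sym β≡γ+g ⟩
      β       ≡⟨ sym α≡β ⟩
      α       ≡⟨ α≡α₀+g ⟩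
      α₀ + g  ≡⟨ cong (_+ g) (dist-self≡0 Dα₀) ⟩
      0 + g   ∎)
      where open ≡-Reasoning

  equidistant⇒farther-in-layer : ∀ {n} {a c l : Fin n} {v w x d p q}
    → Dist (K n □ H) (combine a v) (combine l x) d → Dist (K n □ H) (combine c w) (combine l x) d
    → Dist H v x p → Dist H w x q → p < q → c ≡ l
  equidistant⇒farther-in-layer {n} Dv Dw Dp Dq p<q
    with dist-□⁻ (K n) H Dv Dp | dist-□⁻ (K n) H Dw Dq
  ... | α , Dα , refl | γ , Dγ , α+p≡γ+q = K-compensates⇒≡ Dα Dγ α+p≡γ+q p<q

  two-landmark-layers : ∀ {n} {l₁ l₂ : Fin n} {x v w : V H} → l₁ ≢ l₂ → ResolvesPair H x v w
    → ∀ (a c : Fin n) → ResolvesPair (K n □ H) (combine l₁ x) (combine a v) (combine c w)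
                      ⊎ ResolvesPair (K n □ H) (combine l₂ x) (combine a v) (combine c w)
  two-landmark-layers {n} {l₁} {l₂} {x} {v} {w} l₁≢l₂ x-resolves a c
    with resolves-or-equidistant (□-connected (K n) H K-connected H-connected)
                                 (combine l₁ x) (combine a v) (combine c w)
  ... | inj₁ resolved = inj₁ resolved
  ... | inj₂ (_ , P-L₁ , Q-L₁) =
    inj₂ λ α β P-L₂ Q-L₂ α≡β →
      l₁≢l₂ (same-layer P-L₁ Q-L₁ P-L₂ (subst (Dist _ Q L₂) (sym α≡β) Q-L₂))
    where
    P Q L₁ L₂ : V (K n □ H)
    P = combine a v
    Q = combine c w
    L₁ = combine l₁ x
    L₂ = combine l₂ x
    same-layer : ∀ {d₁ d₂} → Dist (K n □ H) P L₁ d₁ → Dist (K n □ H) Q L₁ d₁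
               → Dist (K n □ H) P L₂ d₂ → Dist (K n □ H) Q L₂ d₂ → l₁ ≡ l₂
    same-layer P-L₁ Q-L₁ P-L₂ Q-L₂
      with connected⇒dist H-connected v x | connected⇒dist H-connected w x
    ... | p , Dp | q , Dq with <-cmp p q
    ... | tri< p<q _ _ = trans (sym (equidistant⇒farther-in-layer P-L₁ Q-L₁ Dp Dq p<q))
                               (equidistant⇒farther-in-layer P-L₂ Q-L₂ Dp Dq p<q)
    ... | tri≈ _ p≡q _ = contradiction p≡q (x-resolves p q Dp Dq)
    ... | tri> _ _ q<p = trans (sym (equidistant⇒farther-in-layer Q-L₁ P-L₁ Dq Dp q<p))
                               (equidistant⇒farther-in-layer Q-L₂ P-L₂ Dq Dp q<p)

  MeetsLayer : ∀ {n} → Subset (n * order H) → Fin n → Set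
  MeetsLayer S a = ∃ λ (v : V H) → combine a v ∈ S

  meetsLayer? : ∀ {n} (S : Subset (n * order H)) (a : Fin n) → Dec (MeetsLayer S a)
  meetsLayer? S a = any? λ (v : V H) → combine a v ∈? S

  unmet-layers-equal : ∀ {n S} {a₀ a₁ : Fin n} → V H → Resolving (K n □ H) S
                     → ¬ MeetsLayer S a₀ → ¬ MeetsLayer S a₁ → a₀ ≡ a₁
  unmet-layers-equal {n} {S} {a₀} {a₁} v₀ S-resolving ∄₀ ∄₁ with a₀ ≟ a₁
  ... | yes a₀≡a₁ = a₀≡a₁
  ... | no a₀≢a₁
    with S-resolving (combine a₀ v₀) (combine a₁ v₀) (a₀≢a₁ ∘ proj₁ ∘ combine-injective _ _ _ _)
  ... | x , x∈S , x-resolves with combine-surjective {n} x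
  ... | c , w , refl with connected⇒dist H-connected v₀ w
  ... | g , Dg = contradiction refl
    (x-resolves (suc g) (suc g) (dist-□ (K n) H (K-dist a₀≢c) Dg) (dist-□ (K n) H (K-dist a₁≢c) Dg))
    where
    a₀≢c : a₀ ≢ c
    a₀≢c refl = ∄₀ (w , x∈S)
    a₁≢c : a₁ ≢ c
    a₁≢c refl = ∄₁ (w , x∈S)

  resolving⇒n∸1≤∣S∣ : ∀ {n S} → V H → Resolving (K n □ H) S → n ∸ 1 ≤ ∣ S ∣
  resolving⇒n∸1≤∣S∣ {zero} _ _ = z≤n
  resolving⇒n∸1≤∣S∣ {suc n} {S} v₀ S-resolving =
    injective⇒≤∣p∣ f f-injective (λ i → proj₂ (met i))
    where
    all-but-one-met : ∃ λ (a₀ : Fin (suc n)) → ∀ a → a ≢ a₀ → MeetsLayer S a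
    all-but-one-met with any? (λ a → ¬? (meetsLayer? {suc n} S a))
    ... | yes (a₀ , ∄₀) = a₀ , λ a a≢a₀ →
      decidable-stable (meetsLayer? {suc n} S a) λ ∄ → a≢a₀ (unmet-layers-equal v₀ S-resolving ∄ ∄₀)
    ... | no ∄unmet = zero , λ a _ → decidable-stable (meetsLayer? {suc n} S a) λ ∄ → ∄unmet (a , ∄)
    a₀ : Fin (suc n)
    a₀ = proj₁ all-but-one-met
    met : ∀ i → MeetsLayer S (punchIn a₀ i)
    met i = proj₂ all-but-one-met _ (punchInᵢ≢i a₀ i)
    f : Fin n → Fin (suc n * order H)
    f i = combine (punchIn a₀ i) (proj₁ (met i))
    f-injective : Injective _≡_ _≡_ f
    f-injective eq = punchIn-injective a₀ _ _ (proj₁ (combine-injective _ _ _ _ eq))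

  landmark-row : ∀ {n} → (Fin n → V H) → Fin (suc n) → Subset (order H)
  landmark-row f zero = ⊥
  landmark-row f (suc i) = ⁅ f i ⁆

  landmarks : ∀ {n} → (Fin n → V H) → Subset (suc n * order H)
  landmarks f = layered (landmark-row f)

  ∈-landmarks : ∀ {n} (f : Fin n → V H) i → combine (suc i) (f i) ∈ landmarks f
  ∈-landmarks f i = ∈-layered (landmark-row f) {suc i} (x∈⁅x⁆ (f i))

  ∣landmarks∣ : ∀ {n} (f : Fin n → V H) → ∣ landmarks f ∣ ≡ n
  ∣landmarks∣ f =
    trans (∣p++q∣≡∣p∣+∣q∣ (⊥ {order H}) _) (cong₂ _+_ (∣⊥∣≡0 (order H)) (∣layered⁅⁆∣ f))

  landmarks-resolving : ∀ {n W} (f : Fin n → V H) → Resolving H W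
    → (∀ {x} → x ∈ W → ∃₂ λ i j → i ≢ j × f i ≡ x × f j ≡ x)
    → Resolving (K (suc n) □ H) (landmarks f)
  landmarks-resolving {n} f W-resolving twice = resolving-□ (K (suc n)) H resolve
    where
    Resolved : V (K (suc n) □ H) → V (K (suc n) □ H) → Set
    Resolved P Q = Σ (V (K (suc n) □ H)) λ x → x ∈ landmarks f × ResolvesPair (K (suc n) □ H) x P Q
    same-column : ∀ a c v → a ≢ c → Resolved (combine a v) (combine c v)
    same-column (suc i) c v a≢c = _ , ∈-landmarks f i , same-column-resolved a≢c v (f i)
    same-column zero (suc i) v _ =
      _ , ∈-landmarks f i
        , resolves-sym (same-column-resolved {a = suc i} {c = zero} (λ ()) v (f i))
    same-column zero zero v 0≢0 = contradiction refl 0≢0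
    resolve : ∀ a v c w → (a , v) ≢ (c , w) → Resolved (combine a v) (combine c w)
    resolve a v c w av≢cw with v ≟ w
    ... | yes refl = same-column a c v λ { refl → av≢cw refl }
    ... | no v≢w with W-resolving v w v≢w
    ... | x , x∈W , x-resolves with twice x∈W
    ... | i , j , i≢j , refl , fj≡fi with two-landmark-layers (i≢j ∘ suc-injective) x-resolves a c
    ... | inj₁ resolved = _ , ∈-landmarks f i , resolved
    ... | inj₂ resolved =
      _ , subst (λ y → combine (suc j) y ∈ landmarks f) fj≡fi (∈-landmarks f j) , resolved

  K□-metricDim : ∀ {n W} → V H → Resolving H W → ∣ W ∣ + ∣ W ∣ ≤ n → IsMetricDim (K (suc n) □ H) n
  K□-metricDim {n} {W} v₀ W-resolving 2∣W∣≤n =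
    (landmarks f , landmarks-resolving f W-resolving twice , ∣landmarks∣ f)
    , λ _ → resolving⇒n∸1≤∣S∣ v₀
    where
    e : Fin ∣ W ∣ → V H
    e = proj₁ (enumerate W)
    f : Fin n → V H
    f = proj₁ (duplicate v₀ e 2∣W∣≤n)
    twice : ∀ {x} → x ∈ W → ∃₂ λ i j → i ≢ j × f i ≡ x × f j ≡ x
    twice x∈W with proj₂ (enumerate W) x∈W
    ... | j , refl = proj₂ (duplicate v₀ e 2∣W∣≤n) j

theorem5p3 : (G : Graph) → 1 ≤ order (raw G) → Connected (raw G)
           → (b : ℕ) → IsMetricDim (raw G) b
           → (n : ℕ) → 2 * b + 1 ≤ n
           → IsMetricDim (K n □ raw G) (n ∸ 1)
theorem5p3 G _ _ _ ((W , _ , refl) , _) zero 2b+1≤0 =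
  contradiction (m+n≤o⇒n≤o (2 * ∣ W ∣) 2b+1≤0) λ ()
theorem5p3 G 0<order connected _ ((W , W-resolving , refl) , _) (suc n) 2b+1≤1+n =
  K□-metricDim (raw G) connected (fromℕ< 0<order) W-resolving 2∣W∣≤n
  where
  2∣W∣≤n : ∣ W ∣ + ∣ W ∣ ≤ n
  2∣W∣≤n = ≤-pred (begin
    suc (∣ W ∣ + ∣ W ∣)  ≡⟨ cong (λ k → suc (∣ W ∣ + k)) (sym (+-identityʳ ∣ W ∣)) ⟩
    suc (2 * ∣ W ∣)      ≡⟨ +-comm 1 (2 * ∣ W ∣) ⟩
    2 * ∣ W ∣ + 1        ≤⟨ 2b+1≤1+n ⟩
    suc n                ∎)
    where open ≤-Reasoning
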